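{- For every integer $n \geq 1$, \[ 2p(n) - 1 = \sum_{(a_1,\dots,a_k) \in \mathcal{A}(n)} \left\lfloor \frac{a_{k-1} + a_k}{a_{k-1} + 1} \right\rfloor, \] where $p(n)$ is the number of partitions of $n$.
   Context: An ascending composition of a positive integer $n$ is a sequence of positive integers $(a_1,\dots,a_k)$ with $k \geq 1$, $a_1 + \dots + a_k = n$ and $a_1 \leq \dots \leq a_k$. $\mathcal{A}(n)$ denotes the set of all ascending compositions of $n$, so $|\mathcal{A}(n)| = p(n)$. By convention $a_0 = 0$ for every ascending composition, so that for the one-part composition $(n)$ the summand is $\lfloor (0+n)/(0+1)\rfloor = n$. -}

module Defs where

open import Data.Nat using (ℕ; zero; suc; _+_; _≤_; _/_)
open import Data.List using (List; []; _∷_)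
open import Data.Nat.ListAction using (sum)
open import Data.List.Relation.Unary.Linked using (Linked)
open import Data.List.Relation.Unary.All using (All)
open import Data.Nat using (NonZero)
open import Data.Product using (_×_)
open import Relation.Binary.PropositionalEquality using (_≡_; _≢_)

IsAscComp : ℕ → List ℕ → Set
IsAscComp n as =
  (as ≢ []) × All (λ a → 1 ≤ a) as × Linked _≤_ as × sum as ≡ n

floorTerm : ℕ → ℕ → ℕ
floorTerm x y = (x + y) / suc x

-- The summand ⌊(a_{k-1} + a_k)/(a_{k-1} + 1)⌋ of a composition,
-- with the convention a₀ = 0 (so for a one-part list (a) it is ⌊a/1⌋ = a).
summandFrom : ℕ → List ℕ → ℕ
summandFrom prev []            = 0
summandFrom prev (a ∷ [])      = floorTerm prev a
summandFrom prev (a ∷ b ∷ as)  = summandFrom a (b ∷ as)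

summand : List ℕ → ℕ
summand as = summandFrom 0 as

-- Sort the ascending compositions of N with all parts > a by their first part b+1: apart from
-- (N) itself, they are b+1 followed by a composition of N−b−1 with all parts > b.  Let C(a, N)
-- be their number and T(a, N) the sum of the summands over those with at least two parts.
-- Then T(a, N) + ⌊N/(a+1)⌋ + 1 = 2·C(a, N) by induction on N: the compositions starting with
-- b+1 < N contribute g_b = ⌊N/(b+2)⌋ + T(b, N−b−1) to T (the first term from the tail (N−b−1))
-- and c_b = C(b, N−b−1) to C, and since ⌊(N−b−1)/(b+1)⌋ + 1 = ⌊N/(b+1)⌋ the induction
-- hypothesis (or, when N−b−1 ≤ b, the fact that both quotients are 1) reads
-- g_b + ⌊N/(b+1)⌋ = ⌊N/(b+2)⌋ + 2·c_b, which telescopes from b = a up to ⌊N/N⌋ = 1.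
-- For a = 0 this is the theorem, since the one-part composition (N) contributes N = ⌊N/1⌋.
module Submission where

open import Defs
open import Data.Nat using (ℕ; zero; suc; _+_; _*_; _∸_; _≤_; _<_; _/_; NonZero; z≤n; s≤s)
open import Data.Nat.Properties
open import Data.Nat.DivMod using (m/n≡1+[m∸n]/n; m<n⇒m/n≡0; n/n≡1)
open import Data.Nat.ListAction using (sum)
open import Data.Nat.ListAction.Properties using (sum-++; sum-↭)
open import Data.Nat.Tactic.RingSolver using (solve-∀)
open import Data.List using (List; []; _∷_; [_]; _++_; length; map; concatMap)
open import Data.List.Properties
  using (map-++; length-++; length-map; map-cong; map-cong-local; concatMap-++; ∷-injectiveˡ; ∷-injectiveʳ)
open import Data.List.Membership.Propositional using (_∈_; find; lose)
open import Data.List.Membership.Propositional.Properties using (∈-map⁺; ∈-map⁻; ∈-concatMap⁺; ∈-concatMap⁻)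
open import Data.List.Membership.Propositional.Properties.WithK using (unique∧set⇒bag)
open import Data.List.Relation.Unary.Any using (here; there)
open import Data.List.Relation.Unary.Any.Properties using (¬Any[])
open import Data.List.Relation.Unary.All as All using (All; []; _∷_)
import Data.List.Relation.Unary.All.Properties as All
import Data.List.Relation.Unary.AllPairs as AllPairs
import Data.List.Relation.Unary.AllPairs.Properties as AllPairs
open import Data.List.Relation.Unary.Linked as Linked using (Linked; [-]; _∷_)
open import Data.List.Relation.Unary.Linked.Properties using (Linked⇒All)
open import Data.List.Relation.Unary.Unique.Propositional using (Unique; []; _∷_)
open import Data.List.Relation.Unary.Unique.Propositional.Properties using (concat⁺)
import Data.List.Relation.Unary.Unique.Propositional.Properties as Unique
open import Data.List.Relation.Binary.Disjoint.Propositional using (Disjoint)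
open import Data.List.Relation.Binary.BagAndSetEquality using (∼bag⇒↭)
open import Data.List.Relation.Binary.Permutation.Propositional using (_↭_; ↭-sym)
open import Data.List.Relation.Binary.Permutation.Propositional.Properties using (↭-length)
import Data.List.Relation.Binary.Permutation.Propositional.Properties as Perm
open import Data.Product using (_×_; _,_; proj₁; proj₂; map₂)
open import Data.Empty using (⊥-elim)
open import Function.Base using (_∘_)
open import Function.Bundles using (_⇔_; mk⇔)
open import Function.Properties.Equivalence using () renaming (trans to ⇔-trans; sym to ⇔-sym)
open import Relation.Nullary using (yes; no)
open import Relation.Binary.PropositionalEquality using (_≡_; _≢_; refl; sym; trans; cong; cong₂; subst; module ≡-Reasoning)
open ≡-Reasoning

[m+n]/m≡1+n/m : ∀ m n .{{_ : NonZero m}} → (m + n) / m ≡ suc (n / m)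
[m+n]/m≡1+n/m m n = trans (m/n≡1+[m∸n]/n (m≤m+n m n)) (cong (λ x → suc (x / m)) (m+n∸m≡n m n))

x+[1+y]≡y+z⇒z∸1≡x : ∀ {x y z} → x + suc y ≡ y + z → z ∸ 1 ≡ x
x+[1+y]≡y+z⇒z∸1≡x {x} {y} {z} eq = cong (_∸ 1) (+-cancelˡ-≡ y z (suc x) (begin
  y + z       ≡⟨ eq ⟨
  x + suc y   ≡⟨ +-suc x y ⟩
  suc x + y   ≡⟨ +-comm (suc x) y ⟩
  y + suc x   ∎))

interval : ℕ → ℕ → List ℕ
interval a zero    = []
interval a (suc k) = a ∷ interval (suc a) k

∈-interval⁻ : ∀ {a b} k → b ∈ interval a k → a ≤ b × b < a + k
∈-interval⁻ {a} (suc k) (here refl) = ≤-refl , m<m+n a (s≤s z≤n)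
∈-interval⁻ {a} {b} (suc k) (there b∈) with ∈-interval⁻ k b∈
... | a<b , b<1+a+k = <⇒≤ a<b , subst (b <_) (sym (+-suc a k)) b<1+a+k

∈-interval⁺ : ∀ {a b} k → a ≤ b → b < a + k → b ∈ interval a k
∈-interval⁺ {a} zero a≤b b<a+0 = ⊥-elim (<⇒≱ (subst (_ <_) (+-identityʳ a) b<a+0) a≤b)
∈-interval⁺ {a} {b} (suc k) a≤b b<a+1+k with a ≟ b
... | yes refl = here refl
... | no a≢b   = there (∈-interval⁺ k (≤∧≢⇒< a≤b a≢b) (subst (b <_) (+-suc a k) b<a+1+k))

∈-interval-∸⁻ : ∀ {a b} m → b ∈ interval a (m ∸ a) → a ≤ b × b < m
∈-interval-∸⁻ {a} {b} m b∈ with a ≤? m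
... | yes a≤m = map₂ (subst (b <_) (m+[n∸m]≡n a≤m)) (∈-interval⁻ (m ∸ a) b∈)
... | no a≰m  = ⊥-elim (¬Any[] (subst (λ k → b ∈ interval a k) (m≤n⇒m∸n≡0 (<⇒≤ (≰⇒> a≰m))) b∈))

∈-interval-∸⁺ : ∀ {a b m} → a ≤ b → b < m → b ∈ interval a (m ∸ a)
∈-interval-∸⁺ {a} {b} {m} a≤b b<m =
  ∈-interval⁺ (m ∸ a) a≤b (subst (b <_) (sym (m+[n∸m]≡n (≤-trans a≤b (<⇒≤ b<m)))) b<m)

interval-unique : ∀ a k → Unique (interval a k)
interval-unique a zero    = []
interval-unique a (suc k) = All.tabulate (<⇒≢ ∘ proj₁ ∘ ∈-interval⁻ k) ∷ interval-unique (suc a) k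

interval-snoc : ∀ a k → interval a (suc k) ≡ interval a k ++ [ a + k ]
interval-snoc a zero    = cong (λ x → [ x ]) (sym (+-identityʳ a))
interval-snoc a (suc k) = cong (a ∷_) (trans (interval-snoc (suc a) k)
  (cong (λ x → interval (suc a) k ++ [ x ]) (sym (+-suc a k))))

telescope : ∀ (g h c : ℕ → ℕ) a k →
  (∀ b → a ≤ b → b < a + k → g b + h b ≡ h (suc b) + 2 * c b) →
  sum (map g (interval a k)) + h a ≡ h (a + k) + 2 * sum (map c (interval a k))
telescope g h c a zero _ = trans (cong h (sym (+-identityʳ a))) (sym (+-identityʳ _))
telescope g h c a (suc k) step = begin
  g a + Σg + h a                   ≡⟨ swap-last (g a) Σg (h a) ⟩
  g a + h a + Σg                   ≡⟨ cong (_+ Σg) (step a ≤-refl (m<m+n a (s≤s z≤n))) ⟩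
  h (suc a) + 2 * c a + Σg         ≡⟨ regroup (h (suc a)) (2 * c a) Σg ⟩
  Σg + h (suc a) + 2 * c a         ≡⟨ cong (_+ 2 * c a) (telescope g h c (suc a) k step′) ⟩
  h (suc a + k) + 2 * Σc + 2 * c a ≡⟨ cong (λ x → h x + 2 * Σc + 2 * c a) (sym (+-suc a k)) ⟩
  h (a + suc k) + 2 * Σc + 2 * c a ≡⟨ collect (h (a + suc k)) Σc (c a) ⟩
  h (a + suc k) + 2 * (c a + Σc)   ∎
  where
  Σg = sum (map g (interval (suc a) k))
  Σc = sum (map c (interval (suc a) k))
  step′ : ∀ b → suc a ≤ b → b < suc a + k → g b + h b ≡ h (suc b) + 2 * c b
  step′ b a<b b<1+a+k = step b (<⇒≤ a<b) (subst (b <_) (sym (+-suc a k)) b<1+a+k)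
  swap-last : ∀ x y z → x + y + z ≡ x + z + y
  swap-last = solve-∀
  regroup : ∀ x y z → x + y + z ≡ z + x + y
  regroup = solve-∀
  collect : ∀ x y z → x + 2 * y + 2 * z ≡ x + 2 * (z + y)
  collect = solve-∀

module _ {ℓ₁ ℓ₂} {A : Set ℓ₁} {B : Set ℓ₂} where

  sum-map-concatMap : ∀ (g : B → ℕ) (F : A → List B) xs →
    sum (map g (concatMap F xs)) ≡ sum (map (λ x → sum (map g (F x))) xs)
  sum-map-concatMap g F []       = refl
  sum-map-concatMap g F (x ∷ xs) = begin
    sum (map g (F x ++ concatMap F xs))               ≡⟨ cong sum (map-++ g (F x) _) ⟩
    sum (map g (F x) ++ map g (concatMap F xs))       ≡⟨ sum-++ (map g (F x)) _ ⟩
    sum (map g (F x)) + sum (map g (concatMap F xs))  ≡⟨ cong (_ +_) (sum-map-concatMap g F xs) ⟩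
    sum (map g (F x)) + sum (map (λ y → sum (map g (F y))) xs) ∎

  length-concatMap : ∀ (F : A → List B) xs → length (concatMap F xs) ≡ sum (map (length ∘ F) xs)
  length-concatMap F []       = refl
  length-concatMap F (x ∷ xs) = trans (length-++ (F x)) (cong (length (F x) +_) (length-concatMap F xs))

  concatMap-unique : ∀ {F : A → List B} {xs} → (∀ x → Unique (F x)) →
    (∀ {x y} → x ≢ y → Disjoint (F x) (F y)) → Unique xs → Unique (concatMap F xs)
  concatMap-unique {F} {xs} unique-F disjoint unique-xs =
    concat⁺ (All.map⁺ (All.universal unique-F xs)) (AllPairs.map⁺ (AllPairs.map disjoint unique-xs))

AscCompAbove : ℕ → ℕ → List ℕ → Set
AscCompAbove a n c = Linked _≤_ (suc a ∷ c) × sum c ≡ n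

isAscComp⇔ascCompAbove0 : ∀ {n c} → 1 ≤ n → IsAscComp n c ⇔ AscCompAbove 0 n c
isAscComp⇔ascCompAbove0 {n} 1≤n = mk⇔ to from
  where
  to : ∀ {c} → IsAscComp n c → AscCompAbove 0 n c
  to {[]}    (c≢[] , _)                     = ⊥-elim (c≢[] refl)
  to {e ∷ d} (_ , 1≤e ∷ _ , linked , sum≡n) = 1≤e ∷ linked , sum≡n
  from : ∀ {c} → AscCompAbove 0 n c → IsAscComp n c
  from {[]}    (_ , 0≡n)        = ⊥-elim (<⇒≢ 1≤n 0≡n)
  from {e ∷ d} (linked , sum≡n) =
    (λ ()) , Linked⇒All ≤-trans (Linked.head linked) (Linked.tail linked) , Linked.tail linked , sum≡n

-- The first argument is fuel: the enumeration is complete once n ≤ fuel.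
mutual
  ascComps : ℕ → ℕ → ℕ → List (List ℕ)
  ascComps _       a zero    = [ [] ]
  ascComps zero    a (suc n) = []
  ascComps (suc f) a (suc n) = concatMap (withFirstPart f n) (interval a (suc n ∸ a))

  withFirstPart : ℕ → ℕ → ℕ → List (List ℕ)
  withFirstPart f n b = map (suc b ∷_) (ascComps f b (n ∸ b))

ascComps-empty : ∀ f {a n} → n < a → ascComps f a (suc n) ≡ []
ascComps-empty zero    _   = refl
ascComps-empty (suc f) n<a rewrite m≤n⇒m∸n≡0 n<a = refl

ascComps-suc : ∀ f {a n} → a ≤ n →
  ascComps (suc f) a (suc n) ≡ concatMap (withFirstPart f n) (interval a (n ∸ a)) ++ [ [ suc n ] ]
ascComps-suc f {a} {n} a≤n = begin
  concatMap W (interval a (suc n ∸ a))          ≡⟨ cong (concatMap W) first-parts ⟩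
  concatMap W (interval a (n ∸ a) ++ [ n ])     ≡⟨ concatMap-++ W (interval a (n ∸ a)) [ n ] ⟩
  concatMap W (interval a (n ∸ a)) ++ W n ++ [] ≡⟨ cong (concatMap W (interval a (n ∸ a)) ++_) last-part ⟩
  concatMap W (interval a (n ∸ a)) ++ [ [ suc n ] ] ∎
  where
  W = withFirstPart f n
  first-parts : interval a (suc n ∸ a) ≡ interval a (n ∸ a) ++ [ n ]
  first-parts = begin
    interval a (suc n ∸ a)              ≡⟨ cong (interval a) (+-∸-assoc 1 a≤n) ⟩
    interval a (suc (n ∸ a))            ≡⟨ interval-snoc a (n ∸ a) ⟩
    interval a (n ∸ a) ++ [ a + (n ∸ a) ] ≡⟨ cong (λ x → interval a (n ∸ a) ++ [ x ]) (m+[n∸m]≡n a≤n) ⟩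
    interval a (n ∸ a) ++ [ n ]         ∎
  last-part : W n ++ [] ≡ [ [ suc n ] ]
  last-part rewrite n∸n≡0 n = refl

∈-ascComps⁻ : ∀ f a n {c} → c ∈ ascComps f a n → AscCompAbove a n c
∈-ascComps⁻ _       a zero    (here refl) = [-] , refl
∈-ascComps⁻ (suc f) a (suc n) c∈
  with find (∈-concatMap⁻ (withFirstPart f n) {interval a (suc n ∸ a)} c∈)
... | b , b∈ , c∈W with ∈-map⁻ (suc b ∷_) c∈W
... | d , d∈ , refl with ∈-interval-∸⁻ (suc n) b∈ | ∈-ascComps⁻ f b (n ∸ b) d∈
... | a≤b , s≤s b≤n | linked , sum≡ = s≤s a≤b ∷ linked , cong suc (trans (cong (b +_) sum≡) (m+[n∸m]≡n b≤n))

∈-ascComps⁺ : ∀ f a n {c} → n ≤ f → AscCompAbove a n c → c ∈ ascComps f a n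
∈-ascComps⁺ _       a zero    {[]}        _  _                  = here refl
∈-ascComps⁺ _       a zero    {zero ∷ d}  _  (() ∷ _ , _)
∈-ascComps⁺ _       a zero    {suc b ∷ d} _  (_ , ())
∈-ascComps⁺ _       a (suc n) {[]}        _  (_ , ())
∈-ascComps⁺ _       a (suc n) {zero ∷ d}  _  (() ∷ _ , _)
∈-ascComps⁺ (suc f) a (suc n) {suc b ∷ d} (s≤s n≤f) (s≤s a≤b ∷ linked , sum≡) =
  ∈-concatMap⁺ (withFirstPart f n) (lose (∈-interval-∸⁺ a≤b (s≤s b≤n))
    (∈-map⁺ (suc b ∷_) (∈-ascComps⁺ f b (n ∸ b) (≤-trans (m∸n≤m n b) n≤f) (linked , sum-d))))
  where
  b+sum-d : b + sum d ≡ n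
  b+sum-d = suc-injective sum≡
  b≤n : b ≤ n
  b≤n = ≤-trans (m≤m+n b (sum d)) (≤-reflexive b+sum-d)
  sum-d : sum d ≡ n ∸ b
  sum-d = trans (sym (m+n∸m≡n b (sum d))) (cong (_∸ b) b+sum-d)

∈-ascComps⇔ : ∀ {f a n c} → n ≤ f → c ∈ ascComps f a n ⇔ AscCompAbove a n c
∈-ascComps⇔ {f} {a} {n} n≤f = mk⇔ (∈-ascComps⁻ f a n) (∈-ascComps⁺ f a n n≤f)

ascComps-nonempty : ∀ f a {n} → 0 < n → All (_≢ []) (ascComps f a n)
ascComps-nonempty f a {n} 0<n = All.tabulate λ c∈ c≡[] →
  <⇒≢ 0<n (trans (cong sum (sym c≡[])) (proj₂ (∈-ascComps⁻ f a n c∈)))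

ascComps-unique : ∀ f a n → Unique (ascComps f a n)
ascComps-unique _       a zero    = [] ∷ []
ascComps-unique zero    a (suc n) = []
ascComps-unique (suc f) a (suc n) =
  concatMap-unique (λ b → Unique.map⁺ ∷-injectiveʳ (ascComps-unique f b (n ∸ b)))
    first-parts-differ (interval-unique a (suc n ∸ a))
  where
  first-parts-differ : ∀ {b b′} → b ≢ b′ → Disjoint (withFirstPart f n b) (withFirstPart f n b′)
  first-parts-differ b≢b′ (c∈ , c∈′) with ∈-map⁻ _ c∈ | ∈-map⁻ _ c∈′
  ... | _ , _ , refl | _ , _ , eq = b≢b′ (suc-injective (∷-injectiveˡ eq))

totalFrom : ℕ → List (List ℕ) → ℕ
totalFrom p cs = sum (map (summandFrom p) cs)

summandFrom-∷ : ∀ p b {d} → d ≢ [] → summandFrom p (b ∷ d) ≡ summandFrom b d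
summandFrom-∷ p b {[]}    d≢[] = ⊥-elim (d≢[] refl)
summandFrom-∷ p b {_ ∷ _} _    = refl

totalFrom-map-∷ : ∀ p b {ds} → All (_≢ []) ds → totalFrom p (map (b ∷_) ds) ≡ totalFrom b ds
totalFrom-map-∷ p b []             = refl
totalFrom-map-∷ p b (d≢[] ∷ ds≢[]) = cong₂ _+_ (summandFrom-∷ p b d≢[]) (totalFrom-map-∷ p b ds≢[])

totalFrom-ascComps-suc : ∀ f p {a n} → a ≤ n →
  totalFrom p (ascComps (suc f) a (suc n))
    ≡ sum (map (λ b → totalFrom (suc b) (ascComps f b (n ∸ b))) (interval a (n ∸ a))) + floorTerm p (suc n)
totalFrom-ascComps-suc f p {a} {n} a≤n = begin
  totalFrom p (ascComps (suc f) a (suc n))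
    ≡⟨ cong (totalFrom p) (ascComps-suc f a≤n) ⟩
  sum (map (summandFrom p) (concatMap W I ++ [ [ suc n ] ]))
    ≡⟨ cong sum (map-++ (summandFrom p) (concatMap W I) _) ⟩
  sum (map (summandFrom p) (concatMap W I) ++ [ floorTerm p (suc n) ])
    ≡⟨ sum-++ (map (summandFrom p) (concatMap W I)) _ ⟩
  totalFrom p (concatMap W I) + (floorTerm p (suc n) + 0)
    ≡⟨ cong₂ _+_ (sum-map-concatMap (summandFrom p) W I) (+-identityʳ _) ⟩
  sum (map (totalFrom p ∘ W) I) + floorTerm p (suc n)
    ≡⟨ cong (λ x → sum x + floorTerm p (suc n)) (map-cong-local (All.tabulate drop-first-part)) ⟩
  sum (map (λ b → totalFrom (suc b) (ascComps f b (n ∸ b))) I) + floorTerm p (suc n) ∎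
  where
  W = withFirstPart f n
  I = interval a (n ∸ a)
  drop-first-part : ∀ {b} → b ∈ I → totalFrom p (W b) ≡ totalFrom (suc b) (ascComps f b (n ∸ b))
  drop-first-part b∈ =
    totalFrom-map-∷ p _ (ascComps-nonempty f _ (m<n⇒0<n∸m (proj₂ (∈-interval-∸⁻ n b∈))))

length-ascComps-suc : ∀ f {a n} → a ≤ n →
  length (ascComps (suc f) a (suc n))
    ≡ sum (map (λ b → length (ascComps f b (n ∸ b))) (interval a (n ∸ a))) + 1
length-ascComps-suc f {a} {n} a≤n = begin
  length (ascComps (suc f) a (suc n))     ≡⟨ cong length (ascComps-suc f a≤n) ⟩
  length (concatMap W I ++ [ [ suc n ] ]) ≡⟨ length-++ (concatMap W I) ⟩
  length (concatMap W I) + 1              ≡⟨ cong (_+ 1) (length-concatMap W I) ⟩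
  sum (map (length ∘ W) I) + 1
    ≡⟨ cong (λ x → sum x + 1) (map-cong (λ b → length-map (suc b ∷_) (ascComps f b (n ∸ b))) I) ⟩
  sum (map (λ b → length (ascComps f b (n ∸ b))) I) + 1 ∎
  where
  W = withFirstPart f n
  I = interval a (n ∸ a)

mutual
  totalFrom-ascComps : ∀ f p a n → a < n → n ≤ f →
    totalFrom p (ascComps f a n) + suc (n / suc a) ≡ floorTerm p n + 2 * length (ascComps f a n)
  totalFrom-ascComps (suc f) p a (suc n) (s≤s a≤n) (s≤s n≤f) = begin
    totalFrom p (ascComps (suc f) a (suc n)) + suc (N / suc a)
      ≡⟨ cong (_+ suc (N / suc a)) (totalFrom-ascComps-suc f p a≤n) ⟩
    sum (map g I) + floorTerm p N + suc (N / suc a)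
      ≡⟨ move-floor (sum (map g I)) (floorTerm p N) (N / suc a) ⟩
    floorTerm p N + suc (sum (map g I) + N / suc a)
      ≡⟨ cong (λ x → floorTerm p N + suc x) (telescope g (λ b → N / suc b) c a (n ∸ a) step) ⟩
    floorTerm p N + suc (N / suc (a + (n ∸ a)) + 2 * sum (map c I))
      ≡⟨ cong (λ x → floorTerm p N + suc (N / suc x + 2 * sum (map c I))) (m+[n∸m]≡n a≤n) ⟩
    floorTerm p N + suc (N / N + 2 * sum (map c I))
      ≡⟨ cong (λ x → floorTerm p N + suc (x + 2 * sum (map c I))) (n/n≡1 N) ⟩
    floorTerm p N + suc (1 + 2 * sum (map c I))
      ≡⟨ cong (floorTerm p N +_) (double-suc (sum (map c I))) ⟩
    floorTerm p N + 2 * (sum (map c I) + 1)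
      ≡⟨ cong (λ x → floorTerm p N + 2 * x) (sym (length-ascComps-suc f a≤n)) ⟩
    floorTerm p N + 2 * length (ascComps (suc f) a (suc n)) ∎
    where
    N = suc n
    I = interval a (n ∸ a)
    g c : ℕ → ℕ
    g b = totalFrom (suc b) (ascComps f b (n ∸ b))
    c b = length (ascComps f b (n ∸ b))
    step : ∀ b → a ≤ b → b < a + (n ∸ a) → g b + N / suc b ≡ N / suc (suc b) + 2 * c b
    step b _ b<a+[n∸a] = subst (λ M → g b + M / suc b ≡ M / suc (suc b) + 2 * c b)
      (cong suc (m+[n∸m]≡n (<⇒≤ b<n)))
      (totalFrom-ascComps-tail f b (n ∸ b) (m<n⇒0<n∸m b<n) (≤-trans (m∸n≤m n b) n≤f))
      where
      b<n : b < n
      b<n = subst (b <_) (m+[n∸m]≡n a≤n) b<a+[n∸a]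
    move-floor : ∀ x y z → x + y + suc z ≡ y + suc (x + z)
    move-floor = solve-∀
    double-suc : ∀ x → suc (1 + 2 * x) ≡ 2 * (x + 1)
    double-suc = solve-∀

  totalFrom-ascComps-tail : ∀ f b k → 0 < k → k ≤ f →
    totalFrom (suc b) (ascComps f b k) + (suc b + k) / suc b
      ≡ (suc b + k) / suc (suc b) + 2 * length (ascComps f b k)
  totalFrom-ascComps-tail f b (suc m) _ 1+m≤f with b ≤? m
  ... | yes b≤m = trans (cong (totalFrom (suc b) (ascComps f b (suc m)) +_) ([m+n]/m≡1+n/m (suc b) (suc m)))
    (totalFrom-ascComps f (suc b) b (suc m) (s≤s b≤m) 1+m≤f)
  ... | no b≰m rewrite ascComps-empty f (≰⇒> b≰m) = begin
    (suc b + suc m) / suc b             ≡⟨ [m+n]/m≡1+n/m (suc b) (suc m) ⟩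
    suc (suc m / suc b)                 ≡⟨ cong suc (m<n⇒m/n≡0 (s≤s m<b)) ⟩
    1                                   ≡⟨ cong suc (m<n⇒m/n≡0 (m≤n⇒m≤1+n (m≤n⇒m≤1+n m<b))) ⟨
    suc (m / suc (suc b))               ≡⟨ [m+n]/m≡1+n/m (suc (suc b)) m ⟨
    (suc (suc b) + m) / suc (suc b)     ≡⟨ cong (_/ suc (suc b)) (+-suc (suc b) m) ⟨
    (suc b + suc m) / suc (suc b)       ≡⟨ +-identityʳ _ ⟨
    (suc b + suc m) / suc (suc b) + 0   ∎
    where
    m<b : m < b
    m<b = ≰⇒> b≰m

mainTheorem1 : ∀ (n : ℕ) → 1 ≤ n →
    (L : List (List ℕ)) → Unique L → (∀ as → (as ∈ L) ⇔ IsAscComp n as) →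
    2 * length L ∸ 1 ≡ sum (map summand L)
mainTheorem1 n 1≤n L unique-L L⇔𝒜 = begin
  2 * length L ∸ 1     ≡⟨ cong (λ l → 2 * l ∸ 1) (↭-length L↭A) ⟩
  2 * length A ∸ 1     ≡⟨ x+[1+y]≡y+z⇒z∸1≡x (totalFrom-ascComps n 0 0 n 1≤n ≤-refl) ⟩
  totalFrom 0 A        ≡⟨ sum-↭ (Perm.map⁺ summand (↭-sym L↭A)) ⟩
  sum (map summand L)  ∎
  where
  A = ascComps n 0 n
  L↭A : L ↭ A
  L↭A = ∼bag⇒↭ (unique∧set⇒bag unique-L (ascComps-unique n 0 n) λ {c} →
    ⇔-trans (L⇔𝒜 c) (⇔-trans (isAscComp⇔ascCompAbove0 1≤n) (⇔-sym (∈-ascComps⇔ ≤-refl))))
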